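{- Let $X$ be a cubic graph of type $C(m,k)$, with cycles $C_1,\dots,C_m,D_1,\dots,D_m$ as below, and let $\Gamma\le\mathrm{Aut}(X)$ act transitively on $V(X)$. Suppose (A1): the setwise stabilizer of $C_1$ in $\Gamma$ acts regularly on the vertices of $C_1$. Write $C_1=v_1v_2\cdots v_k$ and $D_1=w_1w_2\cdots w_k$ with $v_1w_1\in E(X)$, and let $\gamma_1,\delta_1\in\Gamma$ satisfy $\gamma_1(v_j)=v_{j+1}$ and $\delta_1(v_j)=w_j$ for $j=1,\dots,k$ (indices modulo $k$). Then $\Gamma$ acts regularly on $V(X)$, and hence $X$ is a Cayley graph of the group generated by $\gamma_1$ and the involution $\delta_1$.
   Context: A cubic vertex-transitive graph $X$ for which $1$ is a simple eigenvalue of the adjacency matrix has an eigenvector $\mathbf{z}\in\{1,-1\}^{V(X)}$ for $1$; set $V^+=\{x\mid\mathbf{z}(x)=1\}$, $V^-=\{x\mid\mathbf{z}(x)=-1\}$. The induced subgraphs $X[V^+]$, $X[V^-]$ are disjoint unions of cycles of a common length, the edges between $V^+$ and $V^-$ form a perfect matching, and $V^\pm$ and the cycles are blocks of imprimitivity of $\mathrm{Aut}(X)$. $X$ is of type $C(m,k)$ if each of $X[V^+]$ and $X[V^-]$ is a disjoint union of $m$ cycles of length $k$; these cycles are $C_1,\dots,C_m$ (in $X[V^+]$) and $D_1,\dots,D_m$ (in $X[V^-]$). The labellings of $C_1,D_1$ are chosen so that elements $\gamma_1,\delta_1$ as in the claim exist in $\Gamma$. -}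

module Defs where

open import Data.Nat using (ℕ; zero; suc; _≤_; _<_)
open import Data.Nat.DivMod using (_mod_)
open import Data.Fin using (Fin; toℕ)
open import Data.Bool using (Bool; true; false; if_then_else_)
open import Data.Rational using (ℚ; 0ℚ; 1ℚ; -_; _+_; _*_)
open import Data.Product using (Σ; ∃; _×_; _,_)
open import Data.Sum using (_⊎_)
open import Data.List using (List; []; _∷_)
open import Data.Fin.Permutation using (Permutation′; _⟨$⟩ʳ_; _⟨$⟩ˡ_; id; flip; _∘ₚ_)
open import Relation.Binary.PropositionalEquality using (_≡_)
open import Relation.Nullary using (¬_)
open import Function.Bundles using (_⇔_)

sumℕ : ∀ {n} → (Fin n → ℕ) → ℕ
sumℕ {zero}  f = 0
sumℕ {suc n} f = f Fin.zero Data.Nat.+ sumℕ (λ i → f (Fin.suc i))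
  where import Data.Nat

sumℚ : ∀ {n} → (Fin n → ℚ) → ℚ
sumℚ {zero}  f = 0ℚ
sumℚ {suc n} f = f Fin.zero + sumℚ (λ i → f (Fin.suc i))

Graph : ℕ → Set
Graph n = Fin n → Fin n → Bool

IsSimple : ∀ {n} → Graph n → Set
IsSimple {n} A = (∀ x y → A x y ≡ A y x) × (∀ x → A x x ≡ false)

degree : ∀ {n} → Graph n → Fin n → ℕ
degree A x = sumℕ (λ y → if A x y then 1 else 0)

IsCubic : ∀ {n} → Graph n → Set
IsCubic A = ∀ x → degree A x ≡ 3

adjAct : ∀ {n} → Graph n → (Fin n → ℚ) → Fin n → ℚ
adjAct A y x = sumℚ (λ u → if A x u then y u else 0ℚ)

IsEigenvector1 : ∀ {n} → Graph n → (Fin n → ℚ) → Set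
IsEigenvector1 A y = ∀ x → adjAct A y x ≡ y x

-- 1 is a simple eigenvalue of A, with eigenvector z: z is a (nonzero)
-- eigenvector for 1 and the 1-eigenspace is spanned by z.
-- (A is real symmetric with integer entries, so algebraic = geometric
--  multiplicity and the eigenspace dimension is the same over ℚ and ℝ.)
Simple1Eigen : ∀ {n} → Graph n → (Fin n → ℚ) → Set
Simple1Eigen A z =
  (¬ (∀ x → z x ≡ 0ℚ)) × IsEigenvector1 A z ×
  (∀ y → IsEigenvector1 A y → ∃ λ c → ∀ x → y x ≡ c * z x)

next : ∀ {k} → Fin k → Fin k
next {suc k} j = suc (toℕ j) mod suc k

firstIx : ∀ {k} → 0 < k → Fin k
firstIx {suc k} _ = Fin.zero

-- X is of type C(m,k) w.r.t. the ±1 eigenvector z, with cycles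
-- C i = (C i 0, C i 1, …, C i (k-1)) of X[V⁺] and D i of X[V⁻].

record TypeC {n} (A : Graph n) (z : Fin n → ℚ) (m k : ℕ)
             (C D : Fin m → Fin k → Fin n) : Set where
  field
    k≥3      : 3 ≤ k
    C⁺       : ∀ i j → z (C i j) ≡ 1ℚ
    D⁻       : ∀ i j → z (D i j) ≡ - 1ℚ
    C-onto   : ∀ x → z x ≡ 1ℚ → ∃ λ i → ∃ λ j → C i j ≡ x
    D-onto   : ∀ x → z x ≡ - 1ℚ → ∃ λ i → ∃ λ j → D i j ≡ x
    C-inj    : ∀ i j i′ j′ → C i j ≡ C i′ j′ → (i ≡ i′) × (j ≡ j′)
    D-inj    : ∀ i j i′ j′ → D i j ≡ D i′ j′ → (i ≡ i′) × (j ≡ j′)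
    C-edges  : ∀ i j i′ j′ → A (C i j) (C i′ j′) ≡ true ⇔
                 ((i ≡ i′) × ((j′ ≡ next j) ⊎ (j ≡ next j′)))
    D-edges  : ∀ i j i′ j′ → A (D i j) (D i′ j′) ≡ true ⇔
                 ((i ≡ i′) × ((j′ ≡ next j) ⊎ (j ≡ next j′)))

Perm : ℕ → Set
Perm n = Permutation′ n

_≈ₚ_ : ∀ {n} → Perm n → Perm n → Set
g ≈ₚ h = ∀ x → g ⟨$⟩ʳ x ≡ h ⟨$⟩ʳ x

IsAut : ∀ {n} → Graph n → Perm n → Set
IsAut A g = ∀ x y → A (g ⟨$⟩ʳ x) (g ⟨$⟩ʳ y) ≡ A x y

record IsSubgroupOfAut {n} (A : Graph n) (Γ : Perm n → Set) : Set where
  field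
    resp   : ∀ g h → g ≈ₚ h → Γ g → Γ h
    has-id : Γ id
    mul    : ∀ g h → Γ g → Γ h → Γ (g ∘ₚ h)
    inv    : ∀ g → Γ g → Γ (flip g)
    aut    : ∀ g → Γ g → IsAut A g

Transitive : ∀ {n} → (Perm n → Set) → Set
Transitive {n} Γ = ∀ x y → ∃ λ g → Γ g × (g ⟨$⟩ʳ x ≡ y)

Regular : ∀ {n} → (Perm n → Set) → Set
Regular {n} Γ = Transitive Γ ×
  (∀ g → Γ g → ∀ x → g ⟨$⟩ʳ x ≡ x → ∀ y → g ⟨$⟩ʳ y ≡ y)

StabRegularOn : ∀ {n k} → (Perm n → Set) → (Fin k → Fin n) → Set
StabRegularOn {n} {k} Γ c =
  let Stab : Perm n → Set
      Stab g = Γ g × (∀ j → ∃ λ j′ → g ⟨$⟩ʳ c j ≡ c j′)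
                   × (∀ j → ∃ λ j′ → g ⟨$⟩ˡ c j ≡ c j′)
  in (∀ j j′ → ∃ λ g → Stab g × (g ⟨$⟩ʳ c j ≡ c j′))
   × (∀ g → Stab g → ∀ j → g ⟨$⟩ʳ c j ≡ c j → ∀ j′ → g ⟨$⟩ʳ c j′ ≡ c j′)

data Letter : Set where
  γ⁺ γ⁻ δ⁺ δ⁻ : Letter

evalWord : ∀ {n} → Perm n → Perm n → List Letter → Fin n → Fin n
evalWord γ δ []         x = x
evalWord γ δ (γ⁺ ∷ w) x = γ ⟨$⟩ʳ evalWord γ δ w x
evalWord γ δ (γ⁻ ∷ w) x = γ ⟨$⟩ˡ evalWord γ δ w x
evalWord γ δ (δ⁺ ∷ w) x = δ ⟨$⟩ʳ evalWord γ δ w x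
evalWord γ δ (δ⁻ ∷ w) x = δ ⟨$⟩ˡ evalWord γ δ w x

InGenerated : ∀ {n} → Perm n → Perm n → Perm n → Set
InGenerated γ δ g = ∃ λ w → ∀ x → evalWord γ δ w x ≡ g ⟨$⟩ʳ x

-- X ≅ Cay(Γ, S) via g ↦ g(v₀), for the regular group Γ:
-- S ⊆ Γ, and g(v₀) ~ h(v₀) iff g⁻¹h ∈ S.  (h ∘ₚ flip g applies h, then g⁻¹.)
IsCayleyVia : ∀ {n} → Graph n → (Perm n → Set) → Fin n → Set₁
IsCayleyVia {n} A Γ v₀ = Σ (Perm n → Set) λ S →
  (∀ s → S s → Γ s) ×
  (∀ s t → s ≈ₚ t → S s → S t) ×
  (∀ g h → Γ g → Γ h →
     (A (g ⟨$⟩ʳ v₀) (h ⟨$⟩ʳ v₀) ≡ true) ⇔ S (h ∘ₚ flip g))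

-- Since 1 is a simple eigenvalue and its eigenvector z is nowhere zero, X is
-- connected (restricting z to a union of components would give a second,
-- independent eigenvector), and every automorphism maps z to ±z.  An element
-- h of Γ fixing v₁ therefore preserves V⁺, so it maps the cycle C₁ into
-- itself, and by (A1) it fixes C₁ pointwise.  The third neighbour w₁ of v₁
-- is its only neighbour in V⁻, so h fixes all three neighbours of v₁;
-- conjugating by the transitive group Γ, any element fixing a vertex fixes
-- its neighbours, and connectivity makes it the identity.  The same
-- uniqueness of the V⁻-neighbour (now of w₁) gives δ₁(w₁) = v₁, so δ₁² fixes
-- v₁ and is trivial.  Finally the neighbours of v₁ are γ₁(v₁), γ₁⁻¹(v₁) and
-- δ₁(v₁), so by connectivity every vertex is a word in γ₁, δ₁ applied to v₁,
-- and regularity turns this into generation of Γ.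
module Submission where

open import Defs
open import Data.Nat using (ℕ; zero; suc; _+_; _≤_; _<_; z≤n; s≤s; z<s)
open import Data.Nat.Properties using (≤-trans; n≤1+n; <⇒≱; suc-injective; +-suc; m+n≡0⇒n≡0)
open import Data.Nat.DivMod using (_%_; n%n≡0; m<n⇒m%n≡m)
open import Data.Fin using (Fin; toℕ; fromℕ; inject₁)
open import Data.Fin.Properties using (_≟_; any?; toℕ-injective; toℕ-fromℕ<; toℕ-fromℕ; toℕ-inject₁; toℕ<n)
open import Data.Fin.Induction using (<-weakInduction)
open import Data.Bool using (Bool; true; false; if_then_else_; _∨_; _∧_)
import Data.Bool.Properties as Bool
open import Data.Rational using (ℚ; 0ℚ; 1ℚ; -_; _*_) renaming (_+_ to _+ℚ_)
open import Data.Rational.Properties using (+-0-commutativeMonoid; *-identityʳ; *-identityˡ; *-assoc; *-zeroˡ)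
open import Data.Product using (∃; _×_; _,_; proj₁; proj₂)
open import Data.Sum using (_⊎_; inj₁; inj₂)
open import Data.Empty using (⊥-elim)
open import Data.List using (List; []; _∷_; _++_)
open import Data.Fin.Permutation using (_⟨$⟩ʳ_; _⟨$⟩ˡ_; id; flip; _∘ₚ_; inverseˡ; inverseʳ)
open import Function.Bundles using (Equivalence; _⇔_; mk⇔)
open import Relation.Binary.PropositionalEquality using (_≡_; _≢_; refl; sym; trans; cong; cong₂; subst; module ≡-Reasoning)
open import Relation.Nullary using (does; yes; no; _×-dec_)
open import Relation.Nullary.Decidable using (dec-true)
import Algebra.Properties.CommutativeMonoid.Sum as MonoidSum

∧≡true : ∀ {a b} → a ∧ b ≡ true → a ≡ true × b ≡ true
∧≡true {true} {true} refl = refl , refl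

true≢false : true ≢ false
true≢false ()

1≢-1 : 1ℚ ≢ - 1ℚ
1≢-1 ()

count : ∀ {n} → (Fin n → Bool) → ℕ
count f = sumℕ (λ x → if f x then 1 else 0)

remove : ∀ {n} → Fin n → (Fin n → Bool) → Fin n → Bool
remove a f x = if does (x ≟ a) then false else f x

remove-keep : ∀ {n} {a x : Fin n} (f : Fin n → Bool) → x ≢ a → remove a f x ≡ f x
remove-keep {a = a} {x} f x≢a with x ≟ a
... | yes x≡a = ⊥-elim (x≢a x≡a)
... | no _ = refl

count-remove : ∀ {n} (f : Fin n → Bool) {a} → f a ≡ true → count f ≡ suc (count (remove a f))
count-remove f {Fin.zero} fa rewrite fa = refl
count-remove f {Fin.suc a} fa =
  trans (cong (f₀ +_) (count-remove (λ i → f (Fin.suc i)) fa)) (+-suc f₀ _)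
  where f₀ = if f Fin.zero then 1 else 0

count≡0⇒false : ∀ {n} (f : Fin n → Bool) → count f ≡ 0 → ∀ x → f x ≡ false
count≡0⇒false f c≡0 Fin.zero with f Fin.zero
... | false = refl
count≡0⇒false f c≡0 (Fin.suc x) =
  count≡0⇒false (λ i → f (Fin.suc i)) (m+n≡0⇒n≡0 (if f Fin.zero then 1 else 0) c≡0) x

count-≤ : ∀ {n} (f : Fin n → Bool) → count f ≤ n
count-≤ {zero} f = z≤n
count-≤ {suc n} f with f Fin.zero
... | true = s≤s (count-≤ (λ i → f (Fin.suc i)))
... | false = ≤-trans (count-≤ (λ i → f (Fin.suc i))) (n≤1+n n)

count-mono : ∀ {n} (f g : Fin n → Bool) → (∀ {x} → f x ≡ true → g x ≡ true) → count f ≤ count g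
count-mono {zero} f g f⊆g = z≤n
count-mono {suc n} f g f⊆g with f Fin.zero in f₀ | g Fin.zero in g₀
... | true | true = s≤s (count-mono (λ i → f (Fin.suc i)) (λ i → g (Fin.suc i)) f⊆g)
... | false | true = ≤-trans (count-mono (λ i → f (Fin.suc i)) (λ i → g (Fin.suc i)) f⊆g) (n≤1+n _)
... | false | false = count-mono (λ i → f (Fin.suc i)) (λ i → g (Fin.suc i)) f⊆g
... | true | false with () ← trans (sym g₀) (f⊆g f₀)

count-< : ∀ {n} (f g : Fin n → Bool) → (∀ {x} → f x ≡ true → g x ≡ true) →
          ∀ {a} → f a ≡ false → g a ≡ true → count f < count g
count-< f g f⊆g {a} fa ga rewrite count-remove g ga = s≤s (count-mono f (remove a g) f⊆g′)
  where
  f⊆g′ : ∀ {x} → f x ≡ true → remove a g x ≡ true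
  f⊆g′ {x} fx = trans (remove-keep g λ { refl → true≢false (trans (sym fx) fa) }) (f⊆g fx)

count≡3⇒one-of : ∀ {n} (f : Fin n → Bool) → count f ≡ 3 → ∀ {a b c y} →
                 f a ≡ true → f b ≡ true → f c ≡ true → a ≢ b → a ≢ c → b ≢ c →
                 f y ≡ true → y ≡ a ⊎ y ≡ b ⊎ y ≡ c
count≡3⇒one-of f c≡3 {a} {b} {c} {y} fa fb fc a≢b a≢c b≢c fy with y ≟ a | y ≟ b | y ≟ c
... | yes y≡a | _ | _ = inj₁ y≡a
... | no _ | yes y≡b | _ = inj₂ (inj₁ y≡b)
... | no _ | no _ | yes y≡c = inj₂ (inj₂ y≡c)
... | no y≢a | no y≢b | no y≢c = ⊥-elim (true≢false (trans (sym f₃y) (count≡0⇒false f₃ f₃-empty y)))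
  where
  f₁ f₂ f₃ : Fin _ → Bool
  f₁ = remove a f
  f₂ = remove b f₁
  f₃ = remove c f₂
  f₁b : f₁ b ≡ true
  f₁b = trans (remove-keep f (λ e → a≢b (sym e))) fb
  f₂c : f₂ c ≡ true
  f₂c = trans (remove-keep f₁ (λ e → b≢c (sym e))) (trans (remove-keep f (λ e → a≢c (sym e))) fc)
  f₃y : f₃ y ≡ true
  f₃y = trans (remove-keep f₂ y≢c) (trans (remove-keep f₁ y≢b) (trans (remove-keep f y≢a) fy))
  f₃-empty : count f₃ ≡ 0
  f₃-empty = suc-injective (trans (sym (count-remove f₂ f₂c)) (suc-injective
               (trans (sym (count-remove f₁ f₁b)) (suc-injective (trans (sym (count-remove f fa)) c≡3)))))

cubic-three-neighbours : ∀ {n} {A : Graph n} → IsCubic A → ∀ {x a b c y} →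
  A x a ≡ true → A x b ≡ true → A x c ≡ true → a ≢ b → a ≢ c → b ≢ c →
  A x y ≡ true → y ≡ a ⊎ y ≡ b ⊎ y ≡ c
cubic-three-neighbours {A = A} cubic {x} = count≡3⇒one-of (A x) (cubic x)

next-inject₁ : ∀ {k} (j : Fin k) → next {suc k} (inject₁ j) ≡ Fin.suc j
next-inject₁ {k} j = toℕ-injective (begin
  toℕ (next (inject₁ j))      ≡⟨ toℕ-fromℕ< _ ⟩
  suc (toℕ (inject₁ j)) % suc k ≡⟨ cong (λ t → suc t % suc k) (toℕ-inject₁ j) ⟩
  suc (toℕ j) % suc k         ≡⟨ m<n⇒m%n≡m (s≤s (toℕ<n j)) ⟩
  suc (toℕ j)                 ∎)
  where open ≡-Reasoning

next-fromℕ : ∀ k → next (fromℕ k) ≡ Fin.zero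
next-fromℕ k = toℕ-injective (begin
  toℕ (next (fromℕ k))      ≡⟨ toℕ-fromℕ< _ ⟩
  suc (toℕ (fromℕ k)) % suc k ≡⟨ cong (λ t → suc t % suc k) (toℕ-fromℕ k) ⟩
  suc k % suc k             ≡⟨ n%n≡0 (suc k) ⟩
  0                         ∎)
  where open ≡-Reasoning

next-induction : ∀ {k} (P : Fin (suc k) → Set) → P Fin.zero → (∀ j → P j → P (next j)) → ∀ j → P j
next-induction P P₀ Pnext = <-weakInduction P P₀ λ j Pj → subst P (next-inject₁ j) (Pnext _ Pj)

module ℚSum = MonoidSum +-0-commutativeMonoid

sumℚ≡sum : ∀ {n} (f : Fin n → ℚ) → sumℚ f ≡ ℚSum.sum f
sumℚ≡sum {zero} f = refl
sumℚ≡sum {suc n} f = cong (f Fin.zero +ℚ_) (sumℚ≡sum (λ i → f (Fin.suc i)))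

sumℚ-cong : ∀ {n} {f g : Fin n → ℚ} → (∀ x → f x ≡ g x) → sumℚ f ≡ sumℚ g
sumℚ-cong {f = f} {g} f≗g =
  trans (sumℚ≡sum f) (trans (ℚSum.sum-cong-≗ f≗g) (sym (sumℚ≡sum g)))

sumℚ-zero : ∀ {n} {f : Fin n → ℚ} → (∀ x → f x ≡ 0ℚ) → sumℚ f ≡ 0ℚ
sumℚ-zero {zero} f≗0 = refl
sumℚ-zero {suc n} f≗0 rewrite f≗0 Fin.zero | sumℚ-zero (λ i → f≗0 (Fin.suc i)) = refl

sumℚ-permute : ∀ {n} (f : Fin n → ℚ) (π : Perm n) → sumℚ (λ x → f (π ⟨$⟩ʳ x)) ≡ sumℚ f
sumℚ-permute f π =
  trans (sumℚ≡sum (λ x → f (π ⟨$⟩ʳ x))) (trans (sym (ℚSum.sum-permute f π)) (sym (sumℚ≡sum f)))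

Connected : ∀ {n} → Graph n → Set₁
Connected {n} A = (P : Fin n → Set) {b : Fin n} → P b →
                  (∀ {u y} → P u → A u y ≡ true → P y) → ∀ y → P y

module OneEigenspace {n} (A : Graph n) (simple : IsSimple A) (z : Fin n → ℚ)
  (z±1 : ∀ x → (z x ≡ 1ℚ) ⊎ (z x ≡ - 1ℚ)) (simple1 : Simple1Eigen A z) where

  private
    adj-sym : ∀ x y → A x y ≡ A y x
    adj-sym = proj₁ simple
    z-eigen : IsEigenvector1 A z
    z-eigen = proj₁ (proj₂ simple1)
    spanned-by-z : ∀ y → IsEigenvector1 A y → ∃ λ c → ∀ x → y x ≡ c * z x
    spanned-by-z = proj₂ (proj₂ simple1)

  z*z≡1 : ∀ x → z x * z x ≡ 1ℚ
  z*z≡1 x with z±1 x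
  ... | inj₁ zx≡1 rewrite zx≡1 = refl
  ... | inj₂ zx≡-1 rewrite zx≡-1 = refl

  eigen-scalar : ∀ (y : Fin n → ℚ) c → (∀ x → y x ≡ c * z x) → ∀ x₀ → c ≡ y x₀ * z x₀
  eigen-scalar y c y≡cz x₀ = begin
    c                   ≡⟨ sym (*-identityʳ c) ⟩
    c * 1ℚ              ≡⟨ cong (c *_) (sym (z*z≡1 x₀)) ⟩
    c * (z x₀ * z x₀)   ≡⟨ sym (*-assoc c (z x₀) (z x₀)) ⟩
    (c * z x₀) * z x₀   ≡⟨ cong (_* z x₀) (sym (y≡cz x₀)) ⟩
    y x₀ * z x₀         ∎
    where open ≡-Reasoning

  aut-preserves-eigen : ∀ g → IsAut A g → ∀ {y} → IsEigenvector1 A y →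
                        IsEigenvector1 A (λ x → y (g ⟨$⟩ʳ x))
  aut-preserves-eigen g g-aut {y} y-eigen x = begin
    sumℚ (λ u → if A x u then y (g ⟨$⟩ʳ u) else 0ℚ)
      ≡⟨ sumℚ-cong (λ u → cong (λ b → if b then y (g ⟨$⟩ʳ u) else 0ℚ) (sym (g-aut x u))) ⟩
    sumℚ (λ u → if A (g ⟨$⟩ʳ x) (g ⟨$⟩ʳ u) then y (g ⟨$⟩ʳ u) else 0ℚ)
      ≡⟨ sumℚ-permute (λ v → if A (g ⟨$⟩ʳ x) v then y v else 0ℚ) g ⟩
    adjAct A y (g ⟨$⟩ʳ x)
      ≡⟨ y-eigen (g ⟨$⟩ʳ x) ⟩
    y (g ⟨$⟩ʳ x) ∎
    where open ≡-Reasoning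

  aut-rescales-z : ∀ g → IsAut A g → ∀ x₀ x → z (g ⟨$⟩ʳ x) ≡ (z (g ⟨$⟩ʳ x₀) * z x₀) * z x
  aut-rescales-z g g-aut x₀ x with spanned-by-z _ (aut-preserves-eigen g g-aut z-eigen)
  ... | c , z∘g≡cz = trans (z∘g≡cz x) (cong (_* z x) (eigen-scalar (λ y → z (g ⟨$⟩ʳ y)) c z∘g≡cz x₀))

  Closed : (Fin n → Bool) → Set
  Closed S = ∀ {x u} → S x ≡ true → A x u ≡ true → S u ≡ true

  restrict : (Fin n → Bool) → Fin n → ℚ
  restrict S x = if S x then z x else 0ℚ

  restrict-eigen : ∀ {S} → Closed S → IsEigenvector1 A (restrict S)
  restrict-eigen {S} closed x with S x in Sx
  ... | true = trans (sumℚ-cong agree) (z-eigen x)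
    where
    agree : ∀ u → (if A x u then restrict S u else 0ℚ) ≡ (if A x u then z u else 0ℚ)
    agree u with A x u in Axu
    ... | false = refl
    ... | true rewrite closed Sx Axu = refl
  ... | false = sumℚ-zero vanish
    where
    vanish : ∀ u → (if A x u then restrict S u else 0ℚ) ≡ 0ℚ
    vanish u with A x u in Axu | S u in Su
    ... | false | _ = refl
    ... | true | false = refl
    ... | true | true with () ← trans (sym (closed Su (trans (adj-sym u x) Axu))) Sx

  -- restrict S is a multiple c·z vanishing off S, so c = 0 unless S is everything.
  closed-total : ∀ {S b} → Closed S → S b ≡ true → ∀ y → S y ≡ true
  closed-total {S} {b} closed Sb y with S y in Sy
  ... | true = refl
  ... | false with spanned-by-z (restrict S) (restrict-eigen closed)
  ... | c , restrict≡cz = ⊥-elim (1≢0 (begin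
    1ℚ                  ≡⟨ sym (z*z≡1 b) ⟩
    z b * z b           ≡⟨ cong (λ s → (if s then z b else 0ℚ) * z b) (sym Sb) ⟩
    restrict S b * z b  ≡⟨ sym (eigen-scalar (restrict S) c restrict≡cz b) ⟩
    c                   ≡⟨ eigen-scalar (restrict S) c restrict≡cz y ⟩
    restrict S y * z y  ≡⟨ cong (λ s → (if s then z y else 0ℚ) * z y) Sy ⟩
    0ℚ * z y            ≡⟨ *-zeroˡ (z y) ⟩
    0ℚ                  ∎))
    where
    open ≡-Reasoning
    1≢0 : 1ℚ ≢ 0ℚ
    1≢0 ()

  step : (Fin n → Bool) → Fin n → Bool
  step S x = S x ∨ does (any? λ u → A x u ∧ S u Bool.≟ true)

  step-inflationary : ∀ S {x} → S x ≡ true → step S x ≡ true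
  step-inflationary S Sx rewrite Sx = refl

  step-from-neighbour : ∀ S {x u} → A x u ≡ true → S u ≡ true → step S x ≡ true
  step-from-neighbour S {x} {u} Axu Su
    rewrite dec-true (any? λ v → A x v ∧ S v Bool.≟ true) (u , cong₂ _∧_ Axu Su) = Bool.∨-zeroʳ (S x)

  step-witness : ∀ S {x} → step S x ≡ true → S x ≡ true ⊎ ∃ λ u → A x u ≡ true × S u ≡ true
  step-witness S {x} Sx′ with S x | any? (λ u → A x u ∧ S u Bool.≟ true)
  ... | true | _ = inj₁ refl
  ... | false | yes (u , p) = inj₂ (u , ∧≡true p)
  step-witness S {x} () | false | no _

  closed-or-grows : ∀ S → Closed S ⊎ count S < count (step S)
  closed-or-grows S with any? (λ u → S u Bool.≟ false ×-dec step S u Bool.≟ true)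
  ... | yes (u , Su , stepSu) = inj₂ (count-< S (step S) (step-inflationary S) Su stepSu)
  ... | no none = inj₁ closed
    where
    closed : Closed S
    closed {x} {u} Sx Axu with S u in Su
    ... | true = refl
    ... | false = ⊥-elim (none (u , Su , step-from-neighbour S (trans (adj-sym u x) Axu) Sx))

  reach : ℕ → Fin n → Fin n → Bool
  reach zero b x = does (x ≟ b)
  reach (suc t) b = step (reach t b)

  reach-base : ∀ t b → reach t b b ≡ true
  reach-base zero b = dec-true (b ≟ b) refl
  reach-base (suc t) b = step-inflationary _ (reach-base t b)

  reach-sound : (P : Fin n → Set) {b : Fin n} → P b → (∀ {u y} → P u → A u y ≡ true → P y) →
                ∀ t {y} → reach t b y ≡ true → P y
  reach-sound P {b} Pb P-closed zero {y} e with y ≟ b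
  ... | yes refl = Pb
  reach-sound P Pb P-closed zero () | no _
  reach-sound P Pb P-closed (suc t) e with step-witness _ e
  ... | inj₁ e′ = reach-sound P Pb P-closed t e′
  ... | inj₂ (u , Ayu , e′) = P-closed (reach-sound P Pb P-closed t e′) (trans (adj-sym _ _) Ayu)

  reach-closes : ∀ b t → (∃ λ s → Closed (reach s b)) ⊎ t < count (reach t b)
  reach-closes b zero = inj₂ (subst (0 <_) (sym (count-remove (reach zero b) {b} (reach-base zero b))) z<s)
  reach-closes b (suc t) with reach-closes b t
  ... | inj₁ closes = inj₁ closes
  ... | inj₂ t<count with closed-or-grows (reach t b)
  ...   | inj₁ closed = inj₁ (t , closed)
  ...   | inj₂ grows = inj₂ (≤-trans (s≤s t<count) grows)

  connected : Connected A
  connected P {b} Pb P-closed y with reach-closes b n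
  ... | inj₂ n<count = ⊥-elim (<⇒≱ n<count (count-≤ _))
  ... | inj₁ (s , closed) = reach-sound P Pb P-closed s (closed-total closed (reach-base s b) y)

module Action {n} (A : Graph n) (Γ : Perm n → Set) (Γ≤Aut : IsSubgroupOfAut A Γ) where

  open IsSubgroupOfAut Γ≤Aut

  adj-transport : ∀ {t} → Γ t → ∀ x y → A (t ⟨$⟩ʳ x) y ≡ A x (t ⟨$⟩ˡ y)
  adj-transport {t} t∈Γ x y = trans (cong (A _) (sym (inverseʳ t))) (aut t t∈Γ x (t ⟨$⟩ˡ y))

  -- Conjugating by t with t(v) = x reduces fixing at x to fixing at v.
  fixes-neighbours-everywhere : Transitive Γ → ∀ v →
    (∀ h → Γ h → h ⟨$⟩ʳ v ≡ v → ∀ {y} → A v y ≡ true → h ⟨$⟩ʳ y ≡ y) →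
    ∀ g → Γ g → ∀ {x u} → g ⟨$⟩ʳ x ≡ x → A x u ≡ true → g ⟨$⟩ʳ u ≡ u
  fixes-neighbours-everywhere transitive v fix-at-v g g∈Γ {x} {u} gx≡x Axu
    with transitive v x
  ... | t , t∈Γ , tv≡x = begin
    g ⟨$⟩ʳ u                                       ≡⟨ cong (g ⟨$⟩ʳ_) (sym (inverseʳ t)) ⟩
    g ⟨$⟩ʳ (t ⟨$⟩ʳ y)                              ≡⟨ sym (inverseʳ t) ⟩
    t ⟨$⟩ʳ (t ⟨$⟩ˡ (g ⟨$⟩ʳ (t ⟨$⟩ʳ y)))          ≡⟨ cong (t ⟨$⟩ʳ_) (fix-at-v h h∈Γ hv≡v Avy) ⟩
    t ⟨$⟩ʳ y                                       ≡⟨ inverseʳ t ⟩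
    u                                              ∎
    where
    open ≡-Reasoning
    y = t ⟨$⟩ˡ u
    h = (t ∘ₚ g) ∘ₚ flip t
    h∈Γ : Γ h
    h∈Γ = mul _ _ (mul t g t∈Γ g∈Γ) (inv t t∈Γ)
    hv≡v : h ⟨$⟩ʳ v ≡ v
    hv≡v = trans (cong (λ q → t ⟨$⟩ˡ (g ⟨$⟩ʳ q)) tv≡x)
             (trans (cong (t ⟨$⟩ˡ_) (trans gx≡x (sym tv≡x))) (inverseˡ t))
    Avy : A v y ≡ true
    Avy = trans (sym (adj-transport t∈Γ v u)) (trans (cong (λ q → A q u) tv≡x) Axu)

  semiregular-from-stabiliser : Connected A → Transitive Γ → ∀ v →
    (∀ h → Γ h → h ⟨$⟩ʳ v ≡ v → ∀ {y} → A v y ≡ true → h ⟨$⟩ʳ y ≡ y) →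
    ∀ g → Γ g → ∀ x → g ⟨$⟩ʳ x ≡ x → ∀ y → g ⟨$⟩ʳ y ≡ y
  semiregular-from-stabiliser connected transitive v fix-at-v g g∈Γ x gx≡x =
    connected (λ y → g ⟨$⟩ʳ y ≡ y) gx≡x
      (fixes-neighbours-everywhere transitive v fix-at-v g g∈Γ)

  cayleyVia : ∀ v → IsCayleyVia A Γ v
  cayleyVia v = S , (λ _ → proj₁) , S-resp , adj⇔S
    where
    S : Perm n → Set
    S s = Γ s × (A v (s ⟨$⟩ʳ v) ≡ true)
    S-resp : ∀ s t → s ≈ₚ t → S s → S t
    S-resp s t s≈t (s∈Γ , Asv) = resp s t s≈t s∈Γ , subst (λ q → A v q ≡ true) (s≈t v) Asv
    adj⇔S : ∀ g h → Γ g → Γ h → (A (g ⟨$⟩ʳ v) (h ⟨$⟩ʳ v) ≡ true) ⇔ S (h ∘ₚ flip g)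
    adj⇔S g h g∈Γ h∈Γ = mk⇔
      (λ adj → mul h (flip g) h∈Γ (inv g g∈Γ) , trans (sym (adj-transport g∈Γ v _)) adj)
      (λ s → trans (adj-transport g∈Γ v _) (proj₂ s))

module Words {n} (Γ : Perm n → Set) {A : Graph n} (Γ≤Aut : IsSubgroupOfAut A Γ)
  (γ δ : Perm n) (γ∈Γ : Γ γ) (δ∈Γ : Γ δ) where

  open IsSubgroupOfAut Γ≤Aut

  letterPerm : Letter → Perm n
  letterPerm γ⁺ = γ
  letterPerm γ⁻ = flip γ
  letterPerm δ⁺ = δ
  letterPerm δ⁻ = flip δ

  letterPerm∈Γ : ∀ ℓ → Γ (letterPerm ℓ)
  letterPerm∈Γ γ⁺ = γ∈Γ
  letterPerm∈Γ γ⁻ = inv γ γ∈Γ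
  letterPerm∈Γ δ⁺ = δ∈Γ
  letterPerm∈Γ δ⁻ = inv δ δ∈Γ

  evalWord-∷ : ∀ ℓ w x → evalWord γ δ (ℓ ∷ w) x ≡ letterPerm ℓ ⟨$⟩ʳ evalWord γ δ w x
  evalWord-∷ γ⁺ w x = refl
  evalWord-∷ γ⁻ w x = refl
  evalWord-∷ δ⁺ w x = refl
  evalWord-∷ δ⁻ w x = refl

  evalWord-++ : ∀ w w′ x → evalWord γ δ (w ++ w′) x ≡ evalWord γ δ w (evalWord γ δ w′ x)
  evalWord-++ [] w′ x = refl
  evalWord-++ (ℓ ∷ w) w′ x = trans (evalWord-∷ ℓ (w ++ w′) x)
    (trans (cong (letterPerm ℓ ⟨$⟩ʳ_) (evalWord-++ w w′ x)) (sym (evalWord-∷ ℓ w _)))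

  wordPerm : List Letter → Perm n
  wordPerm [] = id
  wordPerm (ℓ ∷ w) = wordPerm w ∘ₚ letterPerm ℓ

  wordPerm∈Γ : ∀ w → Γ (wordPerm w)
  wordPerm∈Γ [] = has-id
  wordPerm∈Γ (ℓ ∷ w) = mul _ _ (wordPerm∈Γ w) (letterPerm∈Γ ℓ)

  evalWord≗wordPerm : ∀ w x → evalWord γ δ w x ≡ wordPerm w ⟨$⟩ʳ x
  evalWord≗wordPerm [] x = refl
  evalWord≗wordPerm (ℓ ∷ w) x = trans (evalWord-∷ ℓ w x) (cong (letterPerm ℓ ⟨$⟩ʳ_) (evalWord≗wordPerm w x))

  words-generate : (∀ g → Γ g → ∀ x → g ⟨$⟩ʳ x ≡ x → ∀ y → g ⟨$⟩ʳ y ≡ y) →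
    ∀ v → (∀ y → ∃ λ w → evalWord γ δ w v ≡ y) → ∀ g → Γ g → InGenerated γ δ g
  words-generate semiregular v orbit g g∈Γ with orbit (g ⟨$⟩ʳ v)
  ... | w , wv≡gv = w , λ x → begin
    evalWord γ δ w x           ≡⟨ evalWord≗wordPerm w x ⟩
    π ⟨$⟩ʳ x                   ≡⟨ cong (π ⟨$⟩ʳ_) (sym (semiregular h h∈Γ v hv≡v x)) ⟩
    π ⟨$⟩ʳ (π ⟨$⟩ˡ (g ⟨$⟩ʳ x)) ≡⟨ inverseʳ π ⟩
    g ⟨$⟩ʳ x                   ∎
    where
    open ≡-Reasoning
    π = wordPerm w
    h = g ∘ₚ flip π
    h∈Γ : Γ h
    h∈Γ = mul g (flip π) g∈Γ (inv π (wordPerm∈Γ w))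
    hv≡v : h ⟨$⟩ʳ v ≡ v
    hv≡v = trans (cong (π ⟨$⟩ˡ_) (trans (sym wv≡gv) (evalWord≗wordPerm w v))) (inverseˡ π)

module TypeCGraph {n} (A : Graph n) (simple : IsSimple A) (cubic : IsCubic A)
  (z : Fin n → ℚ) (z±1 : ∀ x → (z x ≡ 1ℚ) ⊎ (z x ≡ - 1ℚ)) (simple1 : Simple1Eigen A z)
  {m k : ℕ} (C D : Fin (suc m) → Fin (suc (suc (suc k))) → Fin n)
  (typeC : TypeC A z (suc m) (suc (suc (suc k))) C D)
  (Γ : Perm n → Set) (Γ≤Aut : IsSubgroupOfAut A Γ) (transitive : Transitive Γ)
  (stabRegular : StabRegularOn Γ (C Fin.zero))
  (v₁~w₁ : A (C Fin.zero Fin.zero) (D Fin.zero Fin.zero) ≡ true)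
  (γ δ : Perm n) (γ∈Γ : Γ γ) (δ∈Γ : Γ δ)
  (γ-rotates : ∀ j → γ ⟨$⟩ʳ C Fin.zero j ≡ C Fin.zero (next j))
  (δ-matches : ∀ j → δ ⟨$⟩ʳ C Fin.zero j ≡ D Fin.zero j) where

  open OneEigenspace A simple z z±1 simple1
  open TypeC typeC
  open IsSubgroupOfAut Γ≤Aut
  open Action A Γ Γ≤Aut
  open Words Γ Γ≤Aut γ δ γ∈Γ δ∈Γ

  c₁ d₁ : Fin (suc (suc (suc k))) → Fin n
  c₁ = C Fin.zero
  d₁ = D Fin.zero

  v₁ w₁ : Fin n
  v₁ = c₁ Fin.zero
  w₁ = d₁ Fin.zero

  one last : Fin (suc (suc (suc k)))
  one = Fin.suc Fin.zero
  last = fromℕ (suc (suc k))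

  one≢last : one ≢ last
  one≢last ()

  sign-separates : ∀ {x y} → z x ≡ 1ℚ → z y ≡ - 1ℚ → x ≢ y
  sign-separates zx zy refl = 1≢-1 (trans (sym zx) zy)

  C≢D : ∀ {i j i′ j′} → C i j ≢ D i′ j′
  C≢D = sign-separates (C⁺ _ _) (D⁻ _ _)

  v₁-neighbours : ∀ {y} → A v₁ y ≡ true → y ≡ c₁ one ⊎ y ≡ c₁ last ⊎ y ≡ w₁
  v₁-neighbours = cubic-three-neighbours cubic
    (Equivalence.from (C-edges _ _ _ _) (refl , inj₁ refl))
    (Equivalence.from (C-edges _ _ _ _) (refl , inj₂ (sym (next-fromℕ (suc (suc k))))))
    v₁~w₁ (λ e → one≢last (proj₂ (C-inj _ _ _ _ e))) C≢D C≢D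

  w₁-neighbours : ∀ {y} → A w₁ y ≡ true → y ≡ d₁ one ⊎ y ≡ d₁ last ⊎ y ≡ v₁
  w₁-neighbours = cubic-three-neighbours cubic
    (Equivalence.from (D-edges _ _ _ _) (refl , inj₁ refl))
    (Equivalence.from (D-edges _ _ _ _) (refl , inj₂ (sym (next-fromℕ (suc (suc k))))))
    (trans (proj₁ simple w₁ v₁) v₁~w₁) (λ e → one≢last (proj₂ (D-inj _ _ _ _ e)))
    (λ e → C≢D (sym e)) (λ e → C≢D (sym e))

  v₁-unique-neighbour⁻ : ∀ {y} → A v₁ y ≡ true → z y ≡ - 1ℚ → y ≡ w₁
  v₁-unique-neighbour⁻ Av₁y zy with v₁-neighbours Av₁y
  ... | inj₁ refl = ⊥-elim (sign-separates (C⁺ _ _) zy refl)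
  ... | inj₂ (inj₁ refl) = ⊥-elim (sign-separates (C⁺ _ _) zy refl)
  ... | inj₂ (inj₂ y≡w₁) = y≡w₁

  w₁-unique-neighbour⁺ : ∀ {y} → A w₁ y ≡ true → z y ≡ 1ℚ → y ≡ v₁
  w₁-unique-neighbour⁺ Aw₁y zy with w₁-neighbours Aw₁y
  ... | inj₁ refl = ⊥-elim (sign-separates zy (D⁻ _ _) refl)
  ... | inj₂ (inj₁ refl) = ⊥-elim (sign-separates zy (D⁻ _ _) refl)
  ... | inj₂ (inj₂ y≡v₁) = y≡v₁

  stabiliser-preserves-z : ∀ h → Γ h → h ⟨$⟩ʳ v₁ ≡ v₁ → ∀ x → z (h ⟨$⟩ʳ x) ≡ z x
  stabiliser-preserves-z h h∈Γ hv₁≡v₁ x = begin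
    z (h ⟨$⟩ʳ x)                 ≡⟨ aut-rescales-z h (aut h h∈Γ) v₁ x ⟩
    (z (h ⟨$⟩ʳ v₁) * z v₁) * z x ≡⟨ cong (λ y → (z y * z v₁) * z x) hv₁≡v₁ ⟩
    (z v₁ * z v₁) * z x          ≡⟨ cong (_* z x) (z*z≡1 v₁) ⟩
    1ℚ * z x                     ≡⟨ *-identityˡ (z x) ⟩
    z x                          ∎
    where open ≡-Reasoning

  -- Walking along C₁: h keeps V⁺, and the only V⁺-neighbours of a vertex of C₁ lie on C₁.
  stabiliser-maps-c₁ : ∀ h → Γ h → h ⟨$⟩ʳ v₁ ≡ v₁ → ∀ j → ∃ λ j′ → h ⟨$⟩ʳ c₁ j ≡ c₁ j′
  stabiliser-maps-c₁ h h∈Γ hv₁≡v₁ = next-induction _ (Fin.zero , hv₁≡v₁) next-on-c₁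
    where
    next-on-c₁ : ∀ j → (∃ λ j′ → h ⟨$⟩ʳ c₁ j ≡ c₁ j′) → ∃ λ j″ → h ⟨$⟩ʳ c₁ (next j) ≡ c₁ j″
    next-on-c₁ j (j′ , hj≡j′)
      with C-onto (h ⟨$⟩ʳ c₁ (next j)) (trans (stabiliser-preserves-z h h∈Γ hv₁≡v₁ _) (C⁺ _ _))
    ... | i , j″ , Cij″≡h-next
      with Equivalence.to (C-edges Fin.zero j′ i j″)
             (trans (cong₂ A (sym hj≡j′) Cij″≡h-next)
                    (trans (aut h h∈Γ _ _) (Equivalence.from (C-edges _ _ _ _) (refl , inj₁ refl))))
    ... | refl , _ = j″ , sym Cij″≡h-next

  stabiliser-fixes-c₁ : ∀ h → Γ h → h ⟨$⟩ʳ v₁ ≡ v₁ → ∀ j → h ⟨$⟩ʳ c₁ j ≡ c₁ j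
  stabiliser-fixes-c₁ h h∈Γ hv₁≡v₁ =
    proj₂ stabRegular h (h∈Γ , stabiliser-maps-c₁ h h∈Γ hv₁≡v₁ ,
                         stabiliser-maps-c₁ (flip h) (inv h h∈Γ) h⁻¹v₁≡v₁) Fin.zero hv₁≡v₁
    where
    h⁻¹v₁≡v₁ : h ⟨$⟩ˡ v₁ ≡ v₁
    h⁻¹v₁≡v₁ = trans (cong (h ⟨$⟩ˡ_) (sym hv₁≡v₁)) (inverseˡ h)

  stabiliser-fixes-neighbours : ∀ h → Γ h → h ⟨$⟩ʳ v₁ ≡ v₁ → ∀ {y} → A v₁ y ≡ true → h ⟨$⟩ʳ y ≡ y
  stabiliser-fixes-neighbours h h∈Γ hv₁≡v₁ Av₁y with v₁-neighbours Av₁y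
  ... | inj₁ refl = stabiliser-fixes-c₁ h h∈Γ hv₁≡v₁ one
  ... | inj₂ (inj₁ refl) = stabiliser-fixes-c₁ h h∈Γ hv₁≡v₁ last
  ... | inj₂ (inj₂ refl) = v₁-unique-neighbour⁻
    (trans (cong (λ q → A q (h ⟨$⟩ʳ w₁)) (sym hv₁≡v₁)) (trans (aut h h∈Γ v₁ w₁) v₁~w₁))
    (trans (stabiliser-preserves-z h h∈Γ hv₁≡v₁ w₁) (D⁻ _ _))

  semiregular : ∀ g → Γ g → ∀ x → g ⟨$⟩ʳ x ≡ x → ∀ y → g ⟨$⟩ʳ y ≡ y
  semiregular = semiregular-from-stabiliser connected transitive v₁ stabiliser-fixes-neighbours

  γ⁻¹v₁≡c₁-last : γ ⟨$⟩ˡ v₁ ≡ c₁ last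
  γ⁻¹v₁≡c₁-last = trans (cong (γ ⟨$⟩ˡ_) (sym (trans (γ-rotates last) (cong c₁ (next-fromℕ _)))))
                        (inverseˡ γ)

  v₁-neighbour-is-letter : ∀ {y} → A v₁ y ≡ true → ∃ λ ℓ → evalWord γ δ (ℓ ∷ []) v₁ ≡ y
  v₁-neighbour-is-letter Av₁y with v₁-neighbours Av₁y
  ... | inj₁ refl = γ⁺ , γ-rotates Fin.zero
  ... | inj₂ (inj₁ refl) = γ⁻ , γ⁻¹v₁≡c₁-last
  ... | inj₂ (inj₂ refl) = δ⁺ , δ-matches Fin.zero

  every-vertex-a-word : ∀ y → ∃ λ w → evalWord γ δ w v₁ ≡ y
  every-vertex-a-word = connected _ ([] , refl) extend
    where
    extend : ∀ {u y} → (∃ λ w → evalWord γ δ w v₁ ≡ u) → A u y ≡ true → ∃ λ w → evalWord γ δ w v₁ ≡ y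
    extend {u} {y} (w , wv₁≡u) Auy with v₁-neighbour-is-letter Av₁π⁻¹y
      where
      π = wordPerm w
      Av₁π⁻¹y : A v₁ (π ⟨$⟩ˡ y) ≡ true
      Av₁π⁻¹y = trans (sym (adj-transport (wordPerm∈Γ w) v₁ y))
                  (trans (cong (λ q → A q y) (trans (sym (evalWord≗wordPerm w v₁)) wv₁≡u)) Auy)
    ... | ℓ , ℓv₁≡π⁻¹y = w ++ ℓ ∷ [] , (begin
      evalWord γ δ (w ++ ℓ ∷ []) v₁             ≡⟨ evalWord-++ w (ℓ ∷ []) v₁ ⟩
      evalWord γ δ w (evalWord γ δ (ℓ ∷ []) v₁) ≡⟨ cong (evalWord γ δ w) ℓv₁≡π⁻¹y ⟩
      evalWord γ δ w (wordPerm w ⟨$⟩ˡ y)        ≡⟨ evalWord≗wordPerm w _ ⟩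
      wordPerm w ⟨$⟩ʳ (wordPerm w ⟨$⟩ˡ y)       ≡⟨ inverseʳ (wordPerm w) ⟩
      y                                         ∎)
      where open ≡-Reasoning

  δw₁≡v₁ : δ ⟨$⟩ʳ w₁ ≡ v₁
  δw₁≡v₁ = w₁-unique-neighbour⁺ Aw₁δw₁ zδw₁
    where
    Aw₁δw₁ : A w₁ (δ ⟨$⟩ʳ w₁) ≡ true
    Aw₁δw₁ = trans (cong (λ q → A q (δ ⟨$⟩ʳ w₁)) (sym (δ-matches Fin.zero)))
                   (trans (aut δ δ∈Γ v₁ w₁) v₁~w₁)
    zδw₁ : z (δ ⟨$⟩ʳ w₁) ≡ 1ℚ
    zδw₁ rewrite aut-rescales-z δ (aut δ δ∈Γ) v₁ w₁ | δ-matches Fin.zero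
               | D⁻ Fin.zero Fin.zero | C⁺ Fin.zero Fin.zero = refl

  δ-involution : ∀ x → δ ⟨$⟩ʳ (δ ⟨$⟩ʳ x) ≡ x
  δ-involution = semiregular (δ ∘ₚ δ) (mul δ δ δ∈Γ δ∈Γ) v₁
                   (trans (cong (δ ⟨$⟩ʳ_) (δ-matches Fin.zero)) δw₁≡v₁)

  generated : ∀ g → Γ g → InGenerated γ δ g
  generated = words-generate semiregular v₁ every-vertex-a-word

theorem5p1 : (n : ℕ) (A : Graph n) → IsSimple A → IsCubic A →
    (z : Fin n → ℚ) → (∀ x → (z x ≡ 1ℚ) ⊎ (z x ≡ - 1ℚ)) → Simple1Eigen A z →
    (m k : ℕ) (C D : Fin m → Fin k → Fin n) → TypeC A z m k C D →
    (0<m : 0 < m) (0<k : 0 < k) →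
    (Γ : Perm n → Set) → IsSubgroupOfAut A Γ → Transitive Γ →
    StabRegularOn Γ (C (firstIx 0<m)) →
    A (C (firstIx 0<m) (firstIx 0<k)) (D (firstIx 0<m) (firstIx 0<k)) ≡ true →
    (γ₁ δ₁ : Perm n) → Γ γ₁ → Γ δ₁ →
    (∀ j → γ₁ ⟨$⟩ʳ C (firstIx 0<m) j ≡ C (firstIx 0<m) (next j)) →
    (∀ j → δ₁ ⟨$⟩ʳ C (firstIx 0<m) j ≡ D (firstIx 0<m) j) →
    Regular Γ
    × (∀ x → δ₁ ⟨$⟩ʳ (δ₁ ⟨$⟩ʳ x) ≡ x)
    × (∀ g → Γ g → InGenerated γ₁ δ₁ g)
    × IsCayleyVia A Γ (C (firstIx 0<m) (firstIx 0<k))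
theorem5p1 n A simple cubic z z±1 simple1 (suc m) (suc (suc (suc k))) C D typeC _ _
           Γ Γ≤Aut transitive stabRegular v₁~w₁ γ δ γ∈Γ δ∈Γ γ-rotates δ-matches =
  (transitive , semiregular) , δ-involution , generated , cayleyVia (C Fin.zero Fin.zero)
  where
  open TypeCGraph A simple cubic z z±1 simple1 C D typeC Γ Γ≤Aut transitive stabRegular
                  v₁~w₁ γ δ γ∈Γ δ∈Γ γ-rotates δ-matches
  open Action A Γ Γ≤Aut
theorem5p1 n A _ _ z _ _ zero k C D _ ()
theorem5p1 n A _ _ z _ _ (suc m) zero C D _ _ ()
theorem5p1 n A _ _ z _ _ (suc m) (suc zero) C D typeC with TypeC.k≥3 typeC
... | s≤s ()
theorem5p1 n A _ _ z _ _ (suc m) (suc (suc zero)) C D typeC with TypeC.k≥3 typeC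
... | s≤s (s≤s ())
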